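{- Let $\mathcal{M}$ be a linear hypermap (in the sense of the context) with flag set $\Phi$ and flag involutions $r_0,r_1,r_2$. Then, in the monodromy group $G=\langle r_0,r_1,r_2\rangle\le \mathrm{Sym}(\Phi)$, $$\langle r_1,r_2\rangle\cap\langle r_0,r_2\rangle=\langle r_2\rangle .$$
   Context: A hypergraph $\mathcal H=(V,X)$ is linear if any two distinct vertices lie in at most one common hyperedge. A graph $\Gamma$ on $V$ is an associated graph of $\mathcal H$ if for every $x\in X$ the induced subgraph $\Gamma[x]$ is a cycle (for $|x|=2$ this is a pair of parallel edges, for $|x|=1$ a loop), and every edge of $\Gamma$ has both ends in a unique hyperedge $y\in X$. A linear hypermap $\mathcal M$ is a 2-cell embedding of an associated graph $\Gamma$ of a connected linear hypergraph $\mathcal H$ in a compact connected surface without boundary such that for each $x\in X$, $\Gamma[x]$ is the boundary of a 2-cell (called a hyperedge of $\mathcal M$) and each edge of $\Gamma$ is incident with exactly two distinct 2-cells; the 2-cells that are not hyperedges are hyperfaces. Standing assumption: $\mathcal H$ has more than one hyperedge and no hyperedge of size 1 (loopless). Each edge $\xi$ of $\Gamma$ lies on exactly one hyperedge and one hyperface. A flag is an arc $(v,\xi)$ ($v$ an end of the edge $\xi$), together with the vertex $v$, the hyperedge and the hyperface containing $\xi$; $\Phi$ is the set of flags. The involutions on $\Phi$ are: $r_0$ sends $(v,\xi)$ to $(v',\xi)$ where $v'$ is the other end of $\xi$ (same edge, hyperedge, hyperface, different vertex); $r_1$ sends $(v,\xi)$ to $(v,\xi')$ where $\xi'$ is the other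 edge at $v$ bounding the same hyperface corner as $\xi$ (same vertex and hyperface, different hyperedge); $r_2$ sends $(v,\xi)$ to $(v,\xi'')$ where $\xi''$ is the other edge at $v$ on the boundary of the same hyperedge as $\xi$ (same vertex and hyperedge, different hyperface). $G=\langle r_0,r_1,r_2\rangle$ is the monodromy group. -}

module Defs where

open import Data.Nat using (ℕ)
open import Data.Fin using (Fin)
open import Data.Fin.Permutation using (Permutation′; _⟨$⟩ʳ_)
open import Data.List using (List; []; _∷_)
open import Data.List.Relation.Unary.All using (All)
open import Data.List.Membership.Propositional using (_∈_)
open import Data.Product using (Σ; ∃; _×_)
open import Data.Sum using (_⊎_)
open import Relation.Binary.PropositionalEquality using (_≡_)
open import Relation.Nullary using (¬_)

data Gen : Set where
  g₀ g₁ g₂ : Gen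

record FlagSystem : Set where
  field
    n  : ℕ
    r₀ r₁ r₂ : Permutation′ n

  Φ : Set
  Φ = Fin n

  r : Gen → Permutation′ n
  r g₀ = r₀
  r g₁ = r₁
  r g₂ = r₂

  eval : List Gen → Φ → Φ
  eval []      f = f
  eval (a ∷ w) f = r a ⟨$⟩ʳ eval w f

  Word : List Gen → Set
  Word S = Σ (List Gen) λ w → All (_∈ S) w

  SameOrbit : List Gen → Φ → Φ → Set
  SameOrbit S f g = Σ (List Gen) λ w → All (_∈ S) w × eval w f ≡ g

  -- membership of a permutation of Φ in the subgroup ⟨ r_i : i ∈ S ⟩ ≤ Sym(Φ)
  -- (the r_i are involutions, so every element of the generated subgroup
  -- is a positive word in the generators)
  InSubgroup : List Gen → Permutation′ n → Set
  InSubgroup S σ = Σ (List Gen) λ w → All (_∈ S) w × (∀ f → eval w f ≡ σ ⟨$⟩ʳ f)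

  SameVertex : Φ → Φ → Set
  SameVertex = SameOrbit (g₁ ∷ g₂ ∷ [])

  SameHyperedge : Φ → Φ → Set
  SameHyperedge = SameOrbit (g₀ ∷ g₂ ∷ [])

record LinearHypermap : Set where
  field
    flags : FlagSystem
  open FlagSystem flags public
  field
    r-invol   : ∀ a f → r a ⟨$⟩ʳ (r a ⟨$⟩ʳ f) ≡ f
    r-fpf     : ∀ a f → ¬ (r a ⟨$⟩ʳ f ≡ f)
    connected : ∀ f g → SameOrbit (g₀ ∷ g₁ ∷ g₂ ∷ []) f g
    -- the boundary of each hyperedge is a cycle: it passes through each
    -- of its vertices exactly once (a vertex and a hyperedge meeting
    -- share exactly the two flags f, r₂ f)
    cycle     : ∀ f g → SameVertex f g → SameHyperedge f g → (g ≡ f) ⊎ (g ≡ r₂ ⟨$⟩ʳ f)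
    loopless  : ∀ f → ∃ λ g → SameHyperedge f g × ¬ SameVertex f g
    manyEdges : ∃ λ f → ∃ λ g → ¬ SameHyperedge f g
    -- linearity: two distinct vertices lie in at most one common hyperedge
    linear    : ∀ f g f′ g′ → ¬ SameVertex f g →
                SameVertex f f′ → SameVertex g g′ →
                SameHyperedge f g → SameHyperedge f′ g′ →
                SameHyperedge f f′

{-# OPTIONS --safe #-}
-- σ in ⟨r₁,r₂⟩ ∩ ⟨r₀,r₂⟩ maps every flag f into the intersection of its vertex and its
-- hyperedge, which by the cycle condition is {f, r₂ f}; replacing σ by r₂σ if necessary,
-- σ fixes a flag. Both ⟨r₀,r₂⟩ and ⟨r₁,r₂⟩ are dihedral groups generated by fixed-point-free
-- involutions, so their reflections have no fixed points and their rotations ρ satisfy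
-- ρ e = e ρ⁻¹ for the generators e: an element of either group fixing f fixes its
-- neighbours r_i f as well. By connectivity σ then fixes every flag.
module Submission where

open import Defs
open import Data.Fin.Permutation using (Permutation′; _⟨$⟩ʳ_; _∘ₚ_)
open import Data.List using ([]; _∷_)
open import Data.List.Membership.Propositional using (_∈_)
open import Data.List.Relation.Unary.All as All using (All; []; _∷_)
open import Data.List.Relation.Unary.Any using (here; there)
open import Data.Nat using (ℕ; zero; suc)
open import Data.Product as Product using (_×_; _,_; proj₁; proj₂)
open import Data.Sum using (_⊎_; inj₁; inj₂; swap)
open import Function using (id; _∘_)
open import Relation.Nullary using (contradiction)
open import Relation.Binary.PropositionalEquality

module Dihedral {A : Set} where
  open import Algebra.Definitions (_≡_ {A = A}) using (Involutive)

  FixedPointFree : (A → A) → Set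
  FixedPointFree f = ∀ x → f x ≢ x

  rot : (A → A) → (A → A) → ℕ → A → A
  rot a b zero    = id
  rot a b (suc k) = a ∘ b ∘ rot a b k

  rot∘a≗a∘rot : ∀ a b k → rot a b k ∘ a ≗ a ∘ rot b a k
  rot∘a≗a∘rot a b zero    x = refl
  rot∘a≗a∘rot a b (suc k) x = cong (a ∘ b) (rot∘a≗a∘rot a b k x)

  rot∘b≗b∘rot : ∀ {b} a → Involutive b → ∀ k → rot a b k ∘ b ≗ b ∘ rot b a k
  rot∘b≗b∘rot     a b-inv zero    x = refl
  rot∘b≗b∘rot {b} a b-inv (suc k) x = begin
    a (b (rot a b k (b x))) ≡⟨ cong (a ∘ b) (rot∘b≗b∘rot a b-inv k x) ⟩
    a (b (b (rot b a k x))) ≡⟨ cong a (b-inv _) ⟩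
    a (rot b a k x)         ≡⟨ b-inv _ ⟨
    b (b (a (rot b a k x))) ∎
    where open ≡-Reasoning

  rot-inverse : ∀ {a b} → Involutive a → Involutive b → ∀ k → rot b a k ∘ rot a b k ≗ id
  rot-inverse         a-inv b-inv zero    x = refl
  rot-inverse {a} {b} a-inv b-inv (suc k) x = begin
    b (a (rot b a k (a (b (rot a b k x))))) ≡⟨ cong (b ∘ a) (rot∘b≗b∘rot b a-inv k _) ⟩
    b (a (a (rot a b k (b (rot a b k x))))) ≡⟨ cong b (a-inv _) ⟩
    b (rot a b k (b (rot a b k x)))         ≡⟨ cong b (rot∘b≗b∘rot a b-inv k _) ⟩
    b (b (rot b a k (rot a b k x)))         ≡⟨ b-inv _ ⟩
    rot b a k (rot a b k x)                 ≡⟨ rot-inverse a-inv b-inv k x ⟩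
    x                                       ∎
    where open ≡-Reasoning

  -- a (ba)^(k+1) is the conjugate of b (ab)^k by a.
  reflection-fixedPointFree : ∀ {a b} → Involutive a → Involutive b →
                              FixedPointFree a → FixedPointFree b →
                              ∀ k → FixedPointFree (a ∘ rot b a k)
  reflection-fixedPointFree         a-inv b-inv a-fpf b-fpf zero    = a-fpf
  reflection-fixedPointFree {a} {b} a-inv b-inv a-fpf b-fpf (suc k) x fixed =
    reflection-fixedPointFree b-inv a-inv b-fpf a-fpf k (a x) (begin
      b (rot a b k (a x))         ≡⟨ a-inv _ ⟨
      a (a (b (rot a b k (a x)))) ≡⟨ cong (a ∘ a ∘ b) (rot∘a≗a∘rot a b k x) ⟩
      a (a (b (a (rot b a k x)))) ≡⟨ cong a fixed ⟩
      a x                         ∎)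
    where open ≡-Reasoning

  rot-fixes-conjugate : ∀ {a b e} → Involutive a → Involutive b → ∀ k →
                        rot a b k ∘ e ≗ e ∘ rot b a k →
                        ∀ {x} → rot a b k x ≡ x → rot a b k (e x) ≡ e x
  rot-fixes-conjugate {a} {b} {e} a-inv b-inv k commute {x} fixed = begin
    rot a b k (e x)               ≡⟨ commute x ⟩
    e (rot b a k x)               ≡⟨ cong (e ∘ rot b a k) fixed ⟨
    e (rot b a k (rot a b k x))   ≡⟨ cong e (rot-inverse a-inv b-inv k x) ⟩
    e x                           ∎
    where open ≡-Reasoning

  data Alternating (a b f : A → A) : Set where
    rotation   : ∀ k → f ≗ rot a b k     → Alternating a b f
    reflection : ∀ k → f ≗ a ∘ rot b a k → Alternating a b f

  Dihedral : (a b f : A → A) → Set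
  Dihedral a b f = Alternating a b f ⊎ Alternating b a f

  a∘-dihedral : ∀ {a b f} → Involutive a → Dihedral a b f → Dihedral a b (a ∘ f)
  a∘-dihedral {a} a-inv (inj₁ (rotation zero    f≗)) = inj₁ (reflection 0 (cong a ∘ f≗))
  a∘-dihedral {a} a-inv (inj₁ (rotation (suc k) f≗)) = inj₂ (reflection k (λ x → trans (cong a (f≗ x)) (a-inv _)))
  a∘-dihedral {a} a-inv (inj₁ (reflection k     f≗)) = inj₂ (rotation k (λ x → trans (cong a (f≗ x)) (a-inv _)))
  a∘-dihedral {a} a-inv (inj₂ (rotation k       f≗)) = inj₁ (reflection k (cong a ∘ f≗))
  a∘-dihedral {a} a-inv (inj₂ (reflection k     f≗)) = inj₁ (rotation (suc k) (cong a ∘ f≗))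

  alternating-fixes-neighbours : ∀ {a b f} → Involutive a → Involutive b →
                                 FixedPointFree a → FixedPointFree b → Alternating a b f →
                                 ∀ {x} → f x ≡ x → f (a x) ≡ a x × f (b x) ≡ b x
  alternating-fixes-neighbours {a} {b} a-inv b-inv a-fpf b-fpf (rotation k f≗) {x} fixed =
    trans (f≗ _) (rot-fixes-conjugate a-inv b-inv k (rot∘a≗a∘rot a b k) rot-fixed) ,
    trans (f≗ _) (rot-fixes-conjugate a-inv b-inv k (rot∘b≗b∘rot a b-inv k) rot-fixed)
    where
    rot-fixed : rot a b k x ≡ x
    rot-fixed = trans (sym (f≗ x)) fixed
  alternating-fixes-neighbours a-inv b-inv a-fpf b-fpf (reflection k f≗) {x} fixed =
    contradiction (trans (sym (f≗ x)) fixed) (reflection-fixedPointFree a-inv b-inv a-fpf b-fpf k x)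

  dihedral-fixes-neighbours : ∀ {a b f} → Involutive a → Involutive b →
                              FixedPointFree a → FixedPointFree b → Dihedral a b f →
                              ∀ {x} → f x ≡ x → f (a x) ≡ a x × f (b x) ≡ b x
  dihedral-fixes-neighbours a-inv b-inv a-fpf b-fpf (inj₁ alt) fixed =
    alternating-fixes-neighbours a-inv b-inv a-fpf b-fpf alt fixed
  dihedral-fixes-neighbours a-inv b-inv a-fpf b-fpf (inj₂ alt) fixed =
    Product.swap (alternating-fixes-neighbours b-inv a-inv b-fpf a-fpf alt fixed)

module Flags (M : LinearHypermap) where
  open LinearHypermap M
  open Dihedral

  InSubgroup⇒SameOrbit : ∀ {S} σ → InSubgroup S σ → ∀ f → SameOrbit S f (σ ⟨$⟩ʳ f)
  InSubgroup⇒SameOrbit σ (w , w∈S , w≗σ) f = w , w∈S , w≗σ f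

  InSubgroup-∘r : ∀ {S a} σ → a ∈ S → InSubgroup S σ → InSubgroup S (σ ∘ₚ r a)
  InSubgroup-∘r {a = a} σ a∈S (w , w∈S , w≗σ) = a ∷ w , a∈S ∷ w∈S , cong (r a ⟨$⟩ʳ_) ∘ w≗σ

  eval-dihedral : ∀ {i j w} → All (_∈ i ∷ j ∷ []) w → Dihedral (r i ⟨$⟩ʳ_) (r j ⟨$⟩ʳ_) (eval w)
  eval-dihedral []                                = inj₁ (rotation 0 (λ _ → refl))
  eval-dihedral {i}     (here refl ∷ w∈S)         = a∘-dihedral (r-invol i) (eval-dihedral w∈S)
  eval-dihedral {j = j} (there (here refl) ∷ w∈S) = swap (a∘-dihedral (r-invol j) (swap (eval-dihedral w∈S)))

  subgroup-fixes-neighbours : ∀ {i j} σ → InSubgroup (i ∷ j ∷ []) σ → ∀ {f} → σ ⟨$⟩ʳ f ≡ f →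
                              σ ⟨$⟩ʳ (r i ⟨$⟩ʳ f) ≡ r i ⟨$⟩ʳ f × σ ⟨$⟩ʳ (r j ⟨$⟩ʳ f) ≡ r j ⟨$⟩ʳ f
  subgroup-fixes-neighbours {i} {j} σ (w , w∈S , w≗σ) fixed =
    Product.map (trans (sym (w≗σ _))) (trans (sym (w≗σ _)))
      (dihedral-fixes-neighbours (r-invol i) (r-invol j) (r-fpf i) (r-fpf j)
        (eval-dihedral w∈S) (trans (w≗σ _) fixed))

  generator-closed⇒everywhere : (P : Φ → Set) → (∀ {f} → P f → ∀ a → P (r a ⟨$⟩ʳ f)) →
                                ∀ {f} → P f → ∀ g → P g
  generator-closed⇒everywhere P closed {f} Pf g with connected f g
  ... | u , _ , refl = along u
    where
    along : ∀ u → P (eval u f)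
    along []      = Pf
    along (a ∷ u) = closed (along u) a

  fixes-flag⇒identity : ∀ σ → InSubgroup (g₁ ∷ g₂ ∷ []) σ → InSubgroup (g₀ ∷ g₂ ∷ []) σ →
                        ∀ {f} → σ ⟨$⟩ʳ f ≡ f → ∀ g → σ ⟨$⟩ʳ g ≡ g
  fixes-flag⇒identity σ σ₁₂ σ₀₂ = generator-closed⇒everywhere (λ g → σ ⟨$⟩ʳ g ≡ g) fixes-neighbours
    where
    fixes-neighbours : ∀ {f} → σ ⟨$⟩ʳ f ≡ f → ∀ a → σ ⟨$⟩ʳ (r a ⟨$⟩ʳ f) ≡ r a ⟨$⟩ʳ f
    fixes-neighbours fixed g₀ = proj₁ (subgroup-fixes-neighbours σ σ₀₂ fixed)
    fixes-neighbours fixed g₁ = proj₁ (subgroup-fixes-neighbours σ σ₁₂ fixed)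
    fixes-neighbours fixed g₂ = proj₂ (subgroup-fixes-neighbours σ σ₁₂ fixed)

  fixes-or-flips-flag⇒∈⟨r₂⟩ : ∀ σ → InSubgroup (g₁ ∷ g₂ ∷ []) σ → InSubgroup (g₀ ∷ g₂ ∷ []) σ →
                              ∀ {f} → σ ⟨$⟩ʳ f ≡ f ⊎ σ ⟨$⟩ʳ f ≡ r₂ ⟨$⟩ʳ f → InSubgroup (g₂ ∷ []) σ
  fixes-or-flips-flag⇒∈⟨r₂⟩ σ σ₁₂ σ₀₂ (inj₁ fixed) = [] , [] , sym ∘ fixes-flag⇒identity σ σ₁₂ σ₀₂ fixed
  fixes-or-flips-flag⇒∈⟨r₂⟩ σ σ₁₂ σ₀₂ {f} (inj₂ flipped) = g₂ ∷ [] , here refl ∷ [] , r₂≗σ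
    where
    r₂σ-identity : ∀ g → r₂ ⟨$⟩ʳ (σ ⟨$⟩ʳ g) ≡ g
    r₂σ-identity = fixes-flag⇒identity (σ ∘ₚ r₂) (InSubgroup-∘r σ (there (here refl)) σ₁₂)
                                       (InSubgroup-∘r σ (there (here refl)) σ₀₂)
                                       (trans (cong (r₂ ⟨$⟩ʳ_) flipped) (r-invol g₂ f))
    r₂≗σ : ∀ g → r₂ ⟨$⟩ʳ g ≡ σ ⟨$⟩ʳ g
    r₂≗σ g = begin
      r₂ ⟨$⟩ʳ g                           ≡⟨ cong (r₂ ⟨$⟩ʳ_) (r₂σ-identity g) ⟨
      r₂ ⟨$⟩ʳ (r₂ ⟨$⟩ʳ (σ ⟨$⟩ʳ g))        ≡⟨ r-invol g₂ _ ⟩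
      σ ⟨$⟩ʳ g                            ∎
      where open ≡-Reasoning

proposition2p4 : (M : LinearHypermap) → (σ : Permutation′ (LinearHypermap.n M)) →
    ((LinearHypermap.InSubgroup M (g₁ ∷ g₂ ∷ []) σ × LinearHypermap.InSubgroup M (g₀ ∷ g₂ ∷ []) σ) → LinearHypermap.InSubgroup M (g₂ ∷ []) σ)
    × (LinearHypermap.InSubgroup M (g₂ ∷ []) σ → LinearHypermap.InSubgroup M (g₁ ∷ g₂ ∷ []) σ × LinearHypermap.InSubgroup M (g₀ ∷ g₂ ∷ []) σ)
proposition2p4 M σ = intersection⊆⟨r₂⟩ , ⟨r₂⟩⊆intersection
  where
  open LinearHypermap M
  open Flags M

  -- Any flag will do; manyEdges merely provides one.
  f₀ : Φ
  f₀ = proj₁ manyEdges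

  intersection⊆⟨r₂⟩ : InSubgroup (g₁ ∷ g₂ ∷ []) σ × InSubgroup (g₀ ∷ g₂ ∷ []) σ → InSubgroup (g₂ ∷ []) σ
  intersection⊆⟨r₂⟩ (σ₁₂ , σ₀₂) = fixes-or-flips-flag⇒∈⟨r₂⟩ σ σ₁₂ σ₀₂
    (cycle f₀ (σ ⟨$⟩ʳ f₀) (InSubgroup⇒SameOrbit σ σ₁₂ f₀) (InSubgroup⇒SameOrbit σ σ₀₂ f₀))

  ⟨r₂⟩⊆intersection : InSubgroup (g₂ ∷ []) σ → InSubgroup (g₁ ∷ g₂ ∷ []) σ × InSubgroup (g₀ ∷ g₂ ∷ []) σ
  ⟨r₂⟩⊆intersection (w , w∈S , w≗σ) = (w , All.map there w∈S , w≗σ) , (w , All.map there w∈S , w≗σ)
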